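{- Let $\mathbf{A}$ be a non-trivial positive K4-algebra. Then $\mathbf{A}$ is simple if and only if either $\mathbf{A}\cong\mathbf{B}_2$ or both of the following hold: (i) for every $a\in A$, $\Box a=1$ if $a=1$ and $\Box a=0$ otherwise, and $\Diamond a=0$ if $a=0$ and $\Diamond a=1$ otherwise; (ii) for all $a,b\in A$ with $0<a<b<1$ there is $c\in A\setminus\{0,1\}$ such that either ($a\le c$ and $b\lor c=1$) or ($c\le b$ and $a\land c=0$).
   Context: A positive modal algebra is a structure $\langle A,\land,\lor,\Box,\Diamond,0,1\rangle$ such that $\langle A,\land,\lor,0,1\rangle$ is a bounded distributive lattice, $\Box 1=1$, $\Diamond 0=0$, and for all $a,b$: $\Box(a\land b)=\Box a\land\Box b$, $\Diamond(a\lor b)=\Diamond a\lor\Diamond b$, $\Box a\land\Diamond b\le\Diamond(a\land b)$, $\Box(a\lor b)\le\Box a\lor\Diamond b$; it is a positive K4-algebra if moreover $\Box a\le\Box\Box a$ and $\Diamond\Diamond a\le\Diamond a$. $\mathbf{B}_2$ is the two-element positive modal algebra $\{0<1\}$ with $\Diamond 1=0$ and $\Box 0=1$. An algebra is simple if its congruence lattice has exactly two elements. -}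

module Defs where

open import Level using (Level; 0ℓ) renaming (suc to lsuc)
open import Data.Bool using (Bool; true; false; _∧_; _∨_; not)
open import Data.Product using (Σ; _×_; _,_; ∃)
open import Data.Sum using (_⊎_)
open import Relation.Binary.PropositionalEquality using (_≡_; refl)
open import Relation.Binary.Structures using (IsEquivalence)
open import Relation.Nullary using (¬_)
open import Algebra.Definitions using (Identity)
open import Algebra.Lattice.Structures using (IsDistributiveLattice)
open import Function.Definitions using (Bijective)

record PositiveModalAlgebra (a : Level) : Set (lsuc a) where
  infixr 7 _⊓_
  infixr 6 _⊔_
  field
    Carrier : Set a
    _⊓_ : Carrier → Carrier → Carrier
    _⊔_ : Carrier → Carrier → Carrier
    □   : Carrier → Carrier
    ◇   : Carrier → Carrier
    𝟎   : Carrier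
    𝟏   : Carrier
    isDistributiveLattice : IsDistributiveLattice _≡_ _⊔_ _⊓_
    ⊔-identity : Identity _≡_ 𝟎 _⊔_
    ⊓-identity : Identity _≡_ 𝟏 _⊓_
    □-𝟏 : □ 𝟏 ≡ 𝟏
    ◇-𝟎 : ◇ 𝟎 ≡ 𝟎
    □-⊓ : ∀ x y → □ (x ⊓ y) ≡ □ x ⊓ □ y
    ◇-⊔ : ∀ x y → ◇ (x ⊔ y) ≡ ◇ x ⊔ ◇ y
    -- x ≤ y is encoded as x ⊓ y ≡ x
    □◇-ax : ∀ x y → (□ x ⊓ ◇ y) ⊓ ◇ (x ⊓ y) ≡ □ x ⊓ ◇ y
    □⊔-ax : ∀ x y → □ (x ⊔ y) ⊓ (□ x ⊔ ◇ y) ≡ □ (x ⊔ y)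

  _≤_ : Carrier → Carrier → Set a
  x ≤ y = x ⊓ y ≡ x

  _<_ : Carrier → Carrier → Set a
  x < y = x ≤ y × ¬ (x ≡ y)

Carrier : ∀ {a} → PositiveModalAlgebra a → Set a
Carrier = PositiveModalAlgebra.Carrier

IsK4 : ∀ {a} → PositiveModalAlgebra a → Set a
IsK4 A = (∀ x → □ x ≤ □ (□ x)) × (∀ x → ◇ (◇ x) ≤ ◇ x)
  where open PositiveModalAlgebra A hiding (Carrier)

NonTrivial : ∀ {a} → PositiveModalAlgebra a → Set a
NonTrivial A = Σ (Carrier A) λ x → Σ (Carrier A) λ y → ¬ (x ≡ y)

record IsCongruence {a} (A : PositiveModalAlgebra a)
                    (θ : Carrier A → Carrier A → Set a) : Set a where
  open PositiveModalAlgebra A hiding (Carrier)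
  field
    isEquivalence : IsEquivalence θ
    ⊓-cong : ∀ {x x′ y y′} → θ x x′ → θ y y′ → θ (x ⊓ y) (x′ ⊓ y′)
    ⊔-cong : ∀ {x x′ y y′} → θ x x′ → θ y y′ → θ (x ⊔ y) (x′ ⊔ y′)
    □-cong : ∀ {x x′} → θ x x′ → θ (□ x) (□ x′)
    ◇-cong : ∀ {x x′} → θ x x′ → θ (◇ x) (◇ x′)

-- Simple: the congruence lattice has exactly two elements, i.e. the identity
-- congruence Δ and the total congruence ∇ are distinct (A is non-trivial)
-- and every congruence is (extensionally) equal to Δ or to ∇.
Simple : ∀ {a} → PositiveModalAlgebra a → Set (lsuc a)
Simple {a} A =
  NonTrivial A ×
  ((θ : Carrier A → Carrier A → Set a) → IsCongruence A θ →
     (∀ x y → θ x y → x ≡ y) ⊎ (∀ x y → θ x y))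

-- The two-element algebra B₂ = {0 < 1} with ◇1 = 0 and □0 = 1
-- (hence ◇x = 0 and □x = 1 for all x).
B₂-□ : Bool → Bool
B₂-□ _ = true

B₂-◇ : Bool → Bool
B₂-◇ _ = false

record IsoToB₂ {a} (A : PositiveModalAlgebra a) : Set a where
  open PositiveModalAlgebra A hiding (Carrier)
  field
    f : Carrier A → Bool
    bijective : Bijective _≡_ _≡_ f
    f-⊓ : ∀ x y → f (x ⊓ y) ≡ f x ∧ f y
    f-⊔ : ∀ x y → f (x ⊔ y) ≡ f x ∨ f y
    f-□ : ∀ x → f (□ x) ≡ B₂-□ (f x)
    f-◇ : ∀ x → f (◇ x) ≡ B₂-◇ (f x)
    f-𝟎 : f 𝟎 ≡ false
    f-𝟏 : f 𝟏 ≡ true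

Cond-i : ∀ {a} → PositiveModalAlgebra a → Set a
Cond-i A = ∀ x →
    (x ≡ 𝟏 → □ x ≡ 𝟏) × (¬ (x ≡ 𝟏) → □ x ≡ 𝟎) ×
    (x ≡ 𝟎 → ◇ x ≡ 𝟎) × (¬ (x ≡ 𝟎) → ◇ x ≡ 𝟏)
  where open PositiveModalAlgebra A hiding (Carrier)

Cond-ii : ∀ {a} → PositiveModalAlgebra a → Set a
Cond-ii A = ∀ x y → 𝟎 < x → x < y → y < 𝟏 →
    Σ (Carrier A) λ c → ¬ (c ≡ 𝟎) × ¬ (c ≡ 𝟏) ×
      ((x ≤ c × y ⊔ c ≡ 𝟏) ⊎ (c ≤ y × x ⊓ c ≡ 𝟎))
  where open PositiveModalAlgebra A hiding (Carrier)

module Submission where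

-- If p ≤ □ p, the kernel of x ↦ x ⊓ p is a congruence, and dually for x ↦ x ⊔ q when ◇ q ≤ q;
-- in a simple algebra both kernels are trivial or total, so p and q lie in {𝟎, 𝟏}.  With the
-- K4 axioms this places every □ x and ◇ x in {𝟎, 𝟏}.  If □ 𝟎 = 𝟏 every element lies below □ x = 𝟏,
-- so A ≅ B₂; otherwise □ and ◇ take the values of condition (i).  For 𝟎 < x < y < 𝟏 the
-- intersection of the kernels of u ↦ u ⊓ x and u ↦ u ⊔ y relates x to y but not 𝟎 to 𝟏, so it is
-- not a congruence; by (i) some related pair is split by □ or ◇, and such a pair yields the c of
-- condition (ii).  Conversely, under (i) and (ii) a congruence relating some p < q can be pushed
-- through c and □ or ◇ to relate 𝟎 and 𝟏, hence is total.

open import Defs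
open import Level using (Level) renaming (suc to lsuc)
open import Data.Bool using (Bool; true; false; _∧_; _∨_)
open import Data.Empty using (⊥)
open import Data.Product using (Σ; _×_; _,_; proj₁; proj₂)
open import Data.Sum using (_⊎_; inj₁; inj₂; [_,_]′)
open import Function.Bundles using (_⇔_; mk⇔)
open import Axiom.ExcludedMiddle using (ExcludedMiddle)
open import Relation.Nullary using (¬_; Dec; yes; no; does; contradiction)
open import Relation.Nullary.Decidable using (dec-true; dec-false; decidable-stable)
open import Relation.Binary.PropositionalEquality
  using (_≡_; _≢_; refl; sym; trans; cong; cong₂; subst₂; module ≡-Reasoning)
open import Relation.Binary.Structures using (IsEquivalence)
open import Algebra.Bundles using (CommutativeSemigroup)
open import Algebra.Structures using (IsCommutativeBand)
open import Algebra.Lattice.Bundles using (Lattice)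
open import Algebra.Lattice.Structures using (IsDistributiveLattice)
import Algebra.Lattice.Properties.Lattice as LatticeProperties
import Algebra.Properties.CommutativeSemigroup as CommutativeSemigroupProperties
import Relation.Binary.Lattice as Order
import Relation.Binary.Lattice.Properties.JoinSemilattice as JoinProperties

module Properties {a} (A : PositiveModalAlgebra a) where
  open PositiveModalAlgebra A public hiding (Carrier)
  open IsDistributiveLattice isDistributiveLattice public
    using ()
    renaming ( ∧-comm to ⊓-comm; ∨-comm to ⊔-comm; ∧-assoc to ⊓-assoc; ∨-assoc to ⊔-assoc
             ; ∧-absorbs-∨ to ⊓-absorbs-⊔; ∨-absorbs-∧ to ⊔-absorbs-⊓
             ; ∧-distribʳ-∨ to ⊓-distribʳ-⊔; ∨-distribʳ-∧ to ⊔-distribʳ-⊓ )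
  open ≡-Reasoning

  lattice : Lattice a a
  lattice = record
    { Carrier   = Carrier A
    ; _≈_       = _≡_
    ; _∨_       = _⊔_
    ; _∧_       = _⊓_
    ; isLattice = IsDistributiveLattice.isLattice isDistributiveLattice
    }

  open LatticeProperties lattice public
    using () renaming (∧-idem to ⊓-idem; ∨-idem to ⊔-idem)

  private
    commutativeSemigroup : (_∙_ : Carrier A → Carrier A → Carrier A) →
      IsCommutativeBand _≡_ _∙_ → CommutativeSemigroup a a
    commutativeSemigroup _∙_ band =
      record { isCommutativeSemigroup = IsCommutativeBand.isCommutativeSemigroup band }
    module ⊓-Semigroup = CommutativeSemigroupProperties
      (commutativeSemigroup _⊓_ (LatticeProperties.∧-isSemilattice lattice))
    module ⊔-Semigroup = CommutativeSemigroupProperties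
      (commutativeSemigroup _⊔_ (LatticeProperties.∨-isSemilattice lattice))
    module ≼ = Order.Lattice (LatticeProperties.∨-∧-orderTheoreticLattice lattice)

  ⊓-distribʳ-⊓ : ∀ p x y → (x ⊓ y) ⊓ p ≡ (x ⊓ p) ⊓ (y ⊓ p)
  ⊓-distribʳ-⊓ p x y = trans (cong ((x ⊓ y) ⊓_) (sym (⊓-idem p))) (⊓-Semigroup.interchange x y p p)

  ⊔-distribʳ-⊔ : ∀ q x y → (x ⊔ y) ⊔ q ≡ (x ⊔ q) ⊔ (y ⊔ q)
  ⊔-distribʳ-⊔ q x y = trans (cong ((x ⊔ y) ⊔_) (sym (⊔-idem q))) (⊔-Semigroup.interchange x y q q)

  ⊓-identityˡ : ∀ x → 𝟏 ⊓ x ≡ x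
  ⊓-identityˡ = proj₁ ⊓-identity

  ⊓-identityʳ : ∀ x → x ⊓ 𝟏 ≡ x
  ⊓-identityʳ = proj₂ ⊓-identity

  ⊔-identityˡ : ∀ x → 𝟎 ⊔ x ≡ x
  ⊔-identityˡ = proj₁ ⊔-identity

  ⊓-zeroˡ : ∀ x → 𝟎 ⊓ x ≡ 𝟎
  ⊓-zeroˡ x = trans (cong (𝟎 ⊓_) (sym (⊔-identityˡ x))) (⊓-absorbs-⊔ 𝟎 x)

  ⊓-zeroʳ : ∀ x → x ⊓ 𝟎 ≡ 𝟎
  ⊓-zeroʳ x = trans (⊓-comm x 𝟎) (⊓-zeroˡ x)

  ⊔-zeroˡ : ∀ x → 𝟏 ⊔ x ≡ 𝟏
  ⊔-zeroˡ x = trans (cong (𝟏 ⊔_) (sym (⊓-identityˡ x))) (⊔-absorbs-⊓ 𝟏 x)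

  -- The library orders a lattice by x ≈ x ∧ y, the symmetric form of _≤_.
  ≤-trans : ∀ {x y z} → x ≤ y → y ≤ z → x ≤ z
  ≤-trans p q = sym (≼.trans (sym p) (sym q))

  ≤-antisym : ∀ {x y} → x ≤ y → y ≤ x → x ≡ y
  ≤-antisym p q = ≼.antisym (sym p) (sym q)

  x⊓y≤x : ∀ x y → (x ⊓ y) ≤ x
  x⊓y≤x x y = sym (≼.x∧y≤x x y)

  x⊓y≤y : ∀ x y → (x ⊓ y) ≤ y
  x⊓y≤y x y = sym (≼.x∧y≤y x y)

  ⊓-greatest : ∀ {x y z} → x ≤ y → x ≤ z → x ≤ (y ⊓ z)
  ⊓-greatest p q = sym (≼.∧-greatest (sym p) (sym q))

  x≤x⊔y : ∀ x y → x ≤ (x ⊔ y)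
  x≤x⊔y x y = sym (≼.x≤x∨y x y)

  y≤x⊔y : ∀ x y → y ≤ (x ⊔ y)
  y≤x⊔y x y = sym (≼.y≤x∨y x y)

  ⊔-least : ∀ {x y z} → x ≤ z → y ≤ z → (x ⊔ y) ≤ z
  ⊔-least p q = sym (≼.∨-least (sym p) (sym q))

  x≤y⇒x⊔y≡y : ∀ {x y} → x ≤ y → x ⊔ y ≡ y
  x≤y⇒x⊔y≡y p = JoinProperties.x≤y⇒x∨y≈y ≼.joinSemilattice (sym p)

  x⊔y≡y⇒x≤y : ∀ {x y} → x ⊔ y ≡ y → x ≤ y
  x⊔y≡y⇒x≤y {x} e = trans (cong (x ⊓_) (sym e)) (⊓-absorbs-⊔ x _)

  x≤𝟏 : ∀ x → x ≤ 𝟏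
  x≤𝟏 = ⊓-identityʳ

  𝟎≤x : ∀ x → 𝟎 ≤ x
  𝟎≤x = ⊓-zeroˡ

  𝟏≤x⇒x≡𝟏 : ∀ {x} → 𝟏 ≤ x → x ≡ 𝟏
  𝟏≤x⇒x≡𝟏 {x} p = trans (sym (⊓-identityˡ x)) p

  x⊓y<x⊔y : ∀ {x y} → x ≢ y → (x ⊓ y) < (x ⊔ y)
  x⊓y<x⊔y {x} {y} x≢y = ≤-trans (x⊓y≤x x y) (x≤x⊔y x y) , λ e →
    x≢y (≤-antisym (≤-trans (x≤x⊔y x y) (subst₂ _≤_ e refl (x⊓y≤y x y)))
                   (≤-trans (y≤x⊔y x y) (subst₂ _≤_ e refl (x⊓y≤x x y))))

  □-mono : ∀ {x y} → x ≤ y → □ x ≤ □ y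
  □-mono {x} {y} p = trans (sym (□-⊓ x y)) (cong □ p)

  ◇-mono : ∀ {x y} → x ≤ y → ◇ x ≤ ◇ y
  ◇-mono {x} {y} p = x⊔y≡y⇒x≤y (trans (sym (◇-⊔ x y)) (cong ◇ (x≤y⇒x⊔y≡y p)))

  nonTrivial⇒𝟎≢𝟏 : NonTrivial A → 𝟎 ≢ 𝟏
  nonTrivial⇒𝟎≢𝟏 (x , y , x≢y) 𝟎≡𝟏 = x≢y (trans (≡𝟎 x) (sym (≡𝟎 y)))
    where
    ≡𝟎 : ∀ z → z ≡ 𝟎
    ≡𝟎 z = trans (sym (⊓-identityʳ z)) (trans (cong (z ⊓_) (sym 𝟎≡𝟏)) (⊓-zeroʳ z))

  □𝟎≡𝟏⇒□x≡𝟏 : □ 𝟎 ≡ 𝟏 → ∀ x → □ x ≡ 𝟏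
  □𝟎≡𝟏⇒□x≡𝟏 □𝟎≡𝟏 x = 𝟏≤x⇒x≡𝟏 (subst₂ _≤_ □𝟎≡𝟏 refl (□-mono (𝟎≤x x)))

  □𝟎≡𝟏⇒◇x≡𝟎 : □ 𝟎 ≡ 𝟏 → ∀ x → ◇ x ≡ 𝟎
  □𝟎≡𝟏⇒◇x≡𝟎 □𝟎≡𝟏 x = begin
    ◇ x                       ≡⟨ ⊓-identityˡ (◇ x) ⟨
    𝟏 ⊓ ◇ x                   ≡⟨ cong (_⊓ ◇ x) □𝟎≡𝟏 ⟨
    □ 𝟎 ⊓ ◇ x                 ≡⟨ □◇-ax 𝟎 x ⟨
    (□ 𝟎 ⊓ ◇ x) ⊓ ◇ (𝟎 ⊓ x)   ≡⟨ cong (λ z → (□ 𝟎 ⊓ ◇ x) ⊓ ◇ z) (⊓-zeroˡ x) ⟩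
    (□ 𝟎 ⊓ ◇ x) ⊓ ◇ 𝟎         ≡⟨ cong ((□ 𝟎 ⊓ ◇ x) ⊓_) ◇-𝟎 ⟩
    (□ 𝟎 ⊓ ◇ x) ⊓ 𝟎           ≡⟨ ⊓-zeroʳ _ ⟩
    𝟎                         ∎

  □𝟎⊔◇𝟏≡𝟏 : □ 𝟎 ⊔ ◇ 𝟏 ≡ 𝟏
  □𝟎⊔◇𝟏≡𝟏 = begin
    □ 𝟎 ⊔ ◇ 𝟏                 ≡⟨ ⊓-identityˡ _ ⟨
    𝟏 ⊓ (□ 𝟎 ⊔ ◇ 𝟏)           ≡⟨ cong (_⊓ (□ 𝟎 ⊔ ◇ 𝟏)) □𝟎⊔𝟏≡𝟏 ⟨
    □ (𝟎 ⊔ 𝟏) ⊓ (□ 𝟎 ⊔ ◇ 𝟏)   ≡⟨ □⊔-ax 𝟎 𝟏 ⟩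
    □ (𝟎 ⊔ 𝟏)                 ≡⟨ □𝟎⊔𝟏≡𝟏 ⟩
    𝟏                         ∎
    where
    □𝟎⊔𝟏≡𝟏 : □ (𝟎 ⊔ 𝟏) ≡ 𝟏
    □𝟎⊔𝟏≡𝟏 = trans (cong □ (⊔-identityˡ 𝟏)) □-𝟏

TwoValued : ∀ {a} → PositiveModalAlgebra a → Set a
TwoValued A = ∀ x → x ≡ 𝟎 ⊎ x ≡ 𝟏
  where open PositiveModalAlgebra A hiding (Carrier)

Kernel : ∀ {a} {C : Set a} → (C → C) → C → C → Set a
Kernel h x y = h x ≡ h y

IntervalKernel : ∀ {a} (A : PositiveModalAlgebra a) → (x y : Carrier A) → Carrier A → Carrier A → Set a
IntervalKernel A x y u v = Kernel (_⊓ x) u v × Kernel (_⊔ y) u v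
  where open PositiveModalAlgebra A hiding (Carrier)

Collapsing : ∀ {a} → PositiveModalAlgebra a → Set (lsuc a)
Collapsing A = ∀ θ → IsCongruence A θ → ∀ {p q} → p < q → θ p q → θ 𝟎 𝟏
  where open PositiveModalAlgebra A hiding (Carrier)

Separator : ∀ {a} (A : PositiveModalAlgebra a) → Carrier A → Carrier A → Set a
Separator A x y = Σ (Carrier A) λ c → ¬ (c ≡ 𝟎) × ¬ (c ≡ 𝟏) ×
  ((x ≤ c × y ⊔ c ≡ 𝟏) ⊎ (c ≤ y × x ⊓ c ≡ 𝟎))
  where open PositiveModalAlgebra A hiding (Carrier)

module _ {a} (A : PositiveModalAlgebra a) where
  open Properties A
  open ≡-Reasoning

  private
    C : Set a
    C = Carrier A

  kernel-cong₂ : ∀ {h : C → C} (_∙_ : C → C → C) → (∀ x y → h (x ∙ y) ≡ h x ∙ h y) →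
    ∀ {x x′ y y′} → Kernel h x x′ → Kernel h y y′ → Kernel h (x ∙ y) (x′ ∙ y′)
  kernel-cong₂ {h} _∙_ h-∙ {x} {x′} {y} {y′} p q = begin
    h (x ∙ y)     ≡⟨ h-∙ x y ⟩
    h x ∙ h y     ≡⟨ cong₂ _∙_ p q ⟩
    h x′ ∙ h y′   ≡⟨ h-∙ x′ y′ ⟨
    h (x′ ∙ y′)   ∎

  kernel-cong₁ : ∀ {h : C → C} (f : C → C) → (∀ x → h (f x) ≡ h (f (h x))) →
    ∀ {x x′} → Kernel h x x′ → Kernel h (f x) (f x′)
  kernel-cong₁ {h} f h-f {x} {x′} p = begin
    h (f x)       ≡⟨ h-f x ⟩
    h (f (h x))   ≡⟨ cong (λ z → h (f z)) p ⟩
    h (f (h x′))  ≡⟨ h-f x′ ⟨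
    h (f x′)      ∎

  kernel-isCongruence : (h : C → C) →
    (∀ x y → h (x ⊓ y) ≡ h x ⊓ h y) → (∀ x y → h (x ⊔ y) ≡ h x ⊔ h y) →
    (∀ x → h (□ x) ≡ h (□ (h x))) → (∀ x → h (◇ x) ≡ h (◇ (h x))) →
    IsCongruence A (Kernel h)
  kernel-isCongruence h h-⊓ h-⊔ h-□ h-◇ = record
    { isEquivalence = record { refl = refl ; sym = sym ; trans = trans }
    ; ⊓-cong = kernel-cong₂ {h = h} _⊓_ h-⊓
    ; ⊔-cong = kernel-cong₂ {h = h} _⊔_ h-⊔
    ; □-cong = kernel-cong₁ {h = h} □ h-□
    ; ◇-cong = kernel-cong₁ {h = h} ◇ h-◇
    }

  meetKernel-isCongruence : ∀ {p} → p ≤ □ p → IsCongruence A (Kernel (_⊓ p))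
  meetKernel-isCongruence {p} p≤□p =
    kernel-isCongruence (_⊓ p) (⊓-distribʳ-⊓ p) (⊓-distribʳ-⊔ p) □-compatible ◇-compatible
    where
    □-compatible : ∀ x → □ x ⊓ p ≡ □ (x ⊓ p) ⊓ p
    □-compatible x = sym (begin
      □ (x ⊓ p) ⊓ p     ≡⟨ cong (_⊓ p) (□-⊓ x p) ⟩
      (□ x ⊓ □ p) ⊓ p   ≡⟨ ⊓-assoc (□ x) (□ p) p ⟩
      □ x ⊓ (□ p ⊓ p)   ≡⟨ cong (□ x ⊓_) (trans (⊓-comm (□ p) p) p≤□p) ⟩
      □ x ⊓ p           ∎)

    -- From p ≤ □ p and the axiom □ p ⊓ ◇ x ≤ ◇ (p ⊓ x) we get ◇ x ⊓ p ≤ ◇ (x ⊓ p).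
    ◇-compatible : ∀ x → ◇ x ⊓ p ≡ ◇ (x ⊓ p) ⊓ p
    ◇-compatible x = ≤-antisym
      (⊓-greatest (≤-trans ◇x⊓p≤□p⊓◇x (subst₂ (λ u v → u ≤ ◇ v) refl (⊓-comm p x) (□◇-ax p x)))
                  (x⊓y≤y (◇ x) p))
      (⊓-greatest (≤-trans (x⊓y≤x _ p) (◇-mono (x⊓y≤x x p))) (x⊓y≤y _ p))
      where
      ◇x⊓p≤□p⊓◇x : (◇ x ⊓ p) ≤ (□ p ⊓ ◇ x)
      ◇x⊓p≤□p⊓◇x = ⊓-greatest (≤-trans (x⊓y≤y (◇ x) p) p≤□p) (x⊓y≤x (◇ x) p)

  joinKernel-isCongruence : ∀ {q} → ◇ q ≤ q → IsCongruence A (Kernel (_⊔ q))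
  joinKernel-isCongruence {q} ◇q≤q =
    kernel-isCongruence (_⊔ q) (⊔-distribʳ-⊓ q) (⊔-distribʳ-⊔ q) □-compatible ◇-compatible
    where
    ◇-compatible : ∀ x → ◇ x ⊔ q ≡ ◇ (x ⊔ q) ⊔ q
    ◇-compatible x = sym (begin
      ◇ (x ⊔ q) ⊔ q     ≡⟨ cong (_⊔ q) (◇-⊔ x q) ⟩
      (◇ x ⊔ ◇ q) ⊔ q   ≡⟨ ⊔-assoc (◇ x) (◇ q) q ⟩
      ◇ x ⊔ (◇ q ⊔ q)   ≡⟨ cong (◇ x ⊔_) (x≤y⇒x⊔y≡y ◇q≤q) ⟩
      ◇ x ⊔ q           ∎)

    -- From ◇ q ≤ q and the axiom □ (x ⊔ q) ≤ □ x ⊔ ◇ q we get □ (x ⊔ q) ≤ □ x ⊔ q.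
    □-compatible : ∀ x → □ x ⊔ q ≡ □ (x ⊔ q) ⊔ q
    □-compatible x = ≤-antisym
      (⊔-least (≤-trans (□-mono (x≤x⊔y x q)) (x≤x⊔y _ q)) (y≤x⊔y _ q))
      (⊔-least (≤-trans (□⊔-ax x q) (⊔-least (x≤x⊔y (□ x) q) (≤-trans ◇q≤q (y≤x⊔y (□ x) q))))
               (y≤x⊔y (□ x) q))

  identifies-𝟎𝟏⇒total : ∀ {θ} → IsCongruence A θ → θ 𝟎 𝟏 → ∀ x y → θ x y
  identifies-𝟎𝟏⇒total {θ} θ-cong θ𝟎𝟏 x y = θ-trans (θ-sym (θ𝟎 x)) (θ𝟎 y)
    where
    open IsCongruence θ-cong
    open IsEquivalence isEquivalence renaming (refl to θ-refl; sym to θ-sym; trans to θ-trans)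
    θ𝟎 : ∀ z → θ 𝟎 z
    θ𝟎 z = subst₂ θ (⊓-zeroʳ z) (⊓-identityʳ z) (⊓-cong (θ-refl {z}) θ𝟎𝟏)

  related⇒meet-join-related : ∀ {θ} → IsCongruence A θ → ∀ {x y} → θ x y → θ (x ⊓ y) (x ⊔ y)
  related⇒meet-join-related {θ} θ-cong {x} θxy =
    θ-trans (subst₂ θ refl (⊓-idem x) (θ-sym (⊓-cong (θ-refl {x}) θxy)))
            (subst₂ θ (⊔-idem x) refl (⊔-cong (θ-refl {x}) θxy))
    where
    open IsCongruence θ-cong
    open IsEquivalence isEquivalence renaming (refl to θ-refl; sym to θ-sym; trans to θ-trans)

  collapsing⇒simple : ExcludedMiddle a → NonTrivial A → Collapsing A → Simple A
  collapsing⇒simple em nt collapse = nt , dichotomy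
    where
    dichotomy : ∀ θ → IsCongruence A θ → (∀ x y → θ x y → x ≡ y) ⊎ (∀ x y → θ x y)
    dichotomy θ θ-cong with em {θ 𝟎 𝟏}
    ... | yes θ𝟎𝟏 = inj₂ (identifies-𝟎𝟏⇒total θ-cong θ𝟎𝟏)
    ... | no ¬θ𝟎𝟏 = inj₁ λ x y θxy → decidable-stable em λ x≢y →
          ¬θ𝟎𝟏 (collapse θ θ-cong (x⊓y<x⊔y x≢y) (related⇒meet-join-related θ-cong θxy))

  twoValued-< : TwoValued A → ∀ {p q} → p < q → p ≡ 𝟎 × q ≡ 𝟏
  twoValued-< twoValued {p} {q} (p≤q , p≢q) with twoValued p | twoValued q
  ... | inj₁ p≡𝟎 | inj₂ q≡𝟏 = p≡𝟎 , q≡𝟏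
  ... | inj₁ p≡𝟎 | inj₁ q≡𝟎 = contradiction (trans p≡𝟎 (sym q≡𝟎)) p≢q
  ... | inj₂ p≡𝟏 | _        =
    contradiction (trans p≡𝟏 (sym (𝟏≤x⇒x≡𝟏 (subst₂ _≤_ p≡𝟏 refl p≤q)))) p≢q

  twoValued⇒collapsing : TwoValued A → Collapsing A
  twoValued⇒collapsing twoValued θ _ p<q θpq with twoValued-< twoValued p<q
  ... | p≡𝟎 , q≡𝟏 = subst₂ θ p≡𝟎 q≡𝟏 θpq

  isoToB₂⇒twoValued : IsoToB₂ A → TwoValued A
  isoToB₂⇒twoValued iso = classify
    where
    open IsoToB₂ iso
    classify : TwoValued A
    classify x with f x in fx
    ... | true  = inj₂ (proj₁ bijective (trans fx (sym f-𝟏)))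
    ... | false = inj₁ (proj₁ bijective (trans fx (sym f-𝟎)))

  twoValued⇒IsoToB₂ : 𝟎 ≢ 𝟏 → TwoValued A → (∀ x → □ x ≡ 𝟏) → (∀ x → ◇ x ≡ 𝟎) → IsoToB₂ A
  twoValued⇒IsoToB₂ 𝟎≢𝟏 twoValued □x≡𝟏 ◇x≡𝟎 = record
    { f         = toBool
    ; bijective = injective , surjective
    ; f-⊓       = toBool-⊓
    ; f-⊔       = toBool-⊔
    ; f-□       = λ x → toBool-𝟏 (□x≡𝟏 x)
    ; f-◇       = λ x → toBool-𝟎 (◇x≡𝟎 x)
    ; f-𝟎       = toBool-𝟎 refl
    ; f-𝟏       = toBool-𝟏 refl
    }
    where
    _≟𝟏 : ∀ x → Dec (x ≡ 𝟏)
    x ≟𝟏 with twoValued x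
    ... | inj₁ x≡𝟎 = no λ x≡𝟏 → 𝟎≢𝟏 (trans (sym x≡𝟎) x≡𝟏)
    ... | inj₂ x≡𝟏 = yes x≡𝟏

    toBool : C → Bool
    toBool x = does (x ≟𝟏)

    toBool-𝟏 : ∀ {x} → x ≡ 𝟏 → toBool x ≡ true
    toBool-𝟏 {x} = dec-true (x ≟𝟏)

    toBool-𝟎 : ∀ {x} → x ≡ 𝟎 → toBool x ≡ false
    toBool-𝟎 {x} x≡𝟎 = dec-false (x ≟𝟏) λ x≡𝟏 → 𝟎≢𝟏 (trans (sym x≡𝟎) x≡𝟏)

    toBool-⊓ : ∀ x y → toBool (x ⊓ y) ≡ toBool x ∧ toBool y
    toBool-⊓ x y = [ (λ x≡𝟎 → trans (toBool-𝟎 (trans (cong (_⊓ y) x≡𝟎) (⊓-zeroˡ y)))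
                                     (sym (cong (_∧ toBool y) (toBool-𝟎 x≡𝟎))))
                   , (λ x≡𝟏 → trans (cong toBool (trans (cong (_⊓ y) x≡𝟏) (⊓-identityˡ y)))
                                     (sym (cong (_∧ toBool y) (toBool-𝟏 x≡𝟏))))
                   ]′ (twoValued x)

    toBool-⊔ : ∀ x y → toBool (x ⊔ y) ≡ toBool x ∨ toBool y
    toBool-⊔ x y = [ (λ x≡𝟎 → trans (cong toBool (trans (cong (_⊔ y) x≡𝟎) (⊔-identityˡ y)))
                                     (sym (cong (_∨ toBool y) (toBool-𝟎 x≡𝟎))))
                   , (λ x≡𝟏 → trans (toBool-𝟏 (trans (cong (_⊔ y) x≡𝟏) (⊔-zeroˡ y)))
                                     (sym (cong (_∨ toBool y) (toBool-𝟏 x≡𝟏))))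
                   ]′ (twoValued x)

    fromBool : Bool → C
    fromBool true  = 𝟏
    fromBool false = 𝟎

    fromBool-toBool : ∀ x → fromBool (toBool x) ≡ x
    fromBool-toBool x = [ (λ x≡𝟎 → trans (cong fromBool (toBool-𝟎 x≡𝟎)) (sym x≡𝟎))
                        , (λ x≡𝟏 → trans (cong fromBool (toBool-𝟏 x≡𝟏)) (sym x≡𝟏))
                        ]′ (twoValued x)

    injective : ∀ {x y} → toBool x ≡ toBool y → x ≡ y
    injective {x} {y} e = begin
      x                   ≡⟨ fromBool-toBool x ⟨
      fromBool (toBool x) ≡⟨ cong fromBool e ⟩
      fromBool (toBool y) ≡⟨ fromBool-toBool y ⟩
      y                   ∎

    surjective : ∀ b → Σ C λ x → ∀ {z} → z ≡ x → toBool z ≡ b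
    surjective true  = 𝟏 , toBool-𝟏
    surjective false = 𝟎 , toBool-𝟎

  module _ (S : Simple A) where
    x≤□x⇒x≡𝟎⊎x≡𝟏 : ∀ {x} → x ≤ □ x → x ≡ 𝟎 ⊎ x ≡ 𝟏
    x≤□x⇒x≡𝟎⊎x≡𝟏 {x} x≤□x with proj₂ S _ (meetKernel-isCongruence x≤□x)
    ... | inj₁ identity = inj₂ (sym (identity 𝟏 x (trans (⊓-identityˡ x) (sym (⊓-idem x)))))
    ... | inj₂ total    = inj₁ (trans (sym (⊓-identityˡ x)) (trans (sym (total 𝟎 𝟏)) (⊓-zeroˡ x)))

    ◇x≤x⇒x≡𝟎⊎x≡𝟏 : ∀ {x} → ◇ x ≤ x → x ≡ 𝟎 ⊎ x ≡ 𝟏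
    ◇x≤x⇒x≡𝟎⊎x≡𝟏 {x} ◇x≤x with proj₂ S _ (joinKernel-isCongruence ◇x≤x)
    ... | inj₁ identity = inj₁ (sym (identity 𝟎 x (trans (⊔-identityˡ x) (sym (⊔-idem x)))))
    ... | inj₂ total    = inj₂ (trans (sym (⊔-identityˡ x)) (trans (total 𝟎 𝟏) (⊔-zeroˡ x)))

    □𝟎≡𝟏⇒twoValued : □ 𝟎 ≡ 𝟏 → TwoValued A
    □𝟎≡𝟏⇒twoValued □𝟎≡𝟏 x =
      x≤□x⇒x≡𝟎⊎x≡𝟏 (subst₂ _≤_ refl (sym (□𝟎≡𝟏⇒□x≡𝟏 □𝟎≡𝟏 x)) (x≤𝟏 x))

    simple⇒Cond-i : IsK4 A → □ 𝟎 ≡ 𝟎 → Cond-i A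
    simple⇒Cond-i (□x≤□□x , ◇◇x≤◇x) □𝟎≡𝟎 x =
      (λ x≡𝟏 → trans (cong □ x≡𝟏) □-𝟏) , □x≡𝟎 , (λ x≡𝟎 → trans (cong ◇ x≡𝟎) ◇-𝟎) , ◇x≡𝟏
      where
      𝟎≢𝟏 : 𝟎 ≢ 𝟏
      𝟎≢𝟏 = nonTrivial⇒𝟎≢𝟏 (proj₁ S)

      □x≡𝟎 : x ≢ 𝟏 → □ x ≡ 𝟎
      □x≡𝟎 x≢𝟏 with x≤□x⇒x≡𝟎⊎x≡𝟏 (□x≤□□x x)
      ... | inj₁ □x≡𝟎 = □x≡𝟎
      ... | inj₂ □x≡𝟏 with x≤□x⇒x≡𝟎⊎x≡𝟏 (subst₂ _≤_ refl (sym □x≡𝟏) (x≤𝟏 x))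
      ...   | inj₁ x≡𝟎 = contradiction (trans (sym □𝟎≡𝟎) (trans (cong □ (sym x≡𝟎)) □x≡𝟏)) 𝟎≢𝟏
      ...   | inj₂ x≡𝟏 = contradiction x≡𝟏 x≢𝟏

      ◇x≡𝟏 : x ≢ 𝟎 → ◇ x ≡ 𝟏
      ◇x≡𝟏 x≢𝟎 with ◇x≤x⇒x≡𝟎⊎x≡𝟏 (◇◇x≤◇x x)
      ... | inj₂ ◇x≡𝟏 = ◇x≡𝟏
      ... | inj₁ ◇x≡𝟎 with ◇x≤x⇒x≡𝟎⊎x≡𝟏 (subst₂ _≤_ (sym ◇x≡𝟎) refl (𝟎≤x x))
      ...   | inj₁ x≡𝟎 = contradiction x≡𝟎 x≢𝟎
      ...   | inj₂ x≡𝟏 = contradiction (begin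
              𝟎           ≡⟨ ⊔-idem 𝟎 ⟨
              𝟎 ⊔ 𝟎       ≡⟨ cong₂ _⊔_ □𝟎≡𝟎 (trans (cong ◇ (sym x≡𝟏)) ◇x≡𝟎) ⟨
              □ 𝟎 ⊔ ◇ 𝟏   ≡⟨ □𝟎⊔◇𝟏≡𝟏 ⟩
              𝟏           ∎) 𝟎≢𝟏

  intervalKernel-sym : ∀ {x y u v} → IntervalKernel A x y u v → IntervalKernel A x y v u
  intervalKernel-sym (p , q) = sym p , sym q

  intervalKernel-isCongruence : ∀ {x y} →
    (∀ {u v} → IntervalKernel A x y u v → □ u ≡ □ v) →
    (∀ {u v} → IntervalKernel A x y u v → ◇ u ≡ ◇ v) →
    IsCongruence A (IntervalKernel A x y)
  intervalKernel-isCongruence {x} {y} □-respects ◇-respects = record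
    { isEquivalence = record
        { refl  = refl , refl
        ; sym   = intervalKernel-sym
        ; trans = λ (p , q) (p′ , q′) → trans p p′ , trans q q′
        }
    ; ⊓-cong = λ (p , q) (p′ , q′) →
        kernel-cong₂ {h = _⊓ x} _⊓_ (⊓-distribʳ-⊓ x) p p′ ,
        kernel-cong₂ {h = _⊔ y} _⊓_ (⊔-distribʳ-⊓ y) q q′
    ; ⊔-cong = λ (p , q) (p′ , q′) →
        kernel-cong₂ {h = _⊓ x} _⊔_ (⊓-distribʳ-⊔ x) p p′ ,
        kernel-cong₂ {h = _⊔ y} _⊔_ (⊔-distribʳ-⊔ y) q q′
    ; □-cong = λ t → cong (_⊓ x) (□-respects t) , cong (_⊔ y) (□-respects t)
    ; ◇-cong = λ t → cong (_⊓ x) (◇-respects t) , cong (_⊔ y) (◇-respects t)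
    }

  intervalKernel-𝟏⇒separator : ∀ {x y v} → 𝟎 ≢ x → IntervalKernel A x y 𝟏 v → v ≢ 𝟏 →
    Separator A x y
  intervalKernel-𝟏⇒separator {x} {y} {v} 𝟎≢x (p , q) v≢𝟏 = v , v≢𝟎 , v≢𝟏 , inj₁ (x≤v , y⊔v≡𝟏)
    where
    x≤v : x ≤ v
    x≤v = trans (⊓-comm x v) (trans (sym p) (⊓-identityˡ x))

    y⊔v≡𝟏 : y ⊔ v ≡ 𝟏
    y⊔v≡𝟏 = trans (⊔-comm y v) (trans (sym q) (⊔-zeroˡ y))

    v≢𝟎 : v ≢ 𝟎
    v≢𝟎 v≡𝟎 = 𝟎≢x (trans (sym (⊓-zeroʳ x)) (trans (cong (x ⊓_) (sym v≡𝟎)) x≤v))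

  intervalKernel-𝟎⇒separator : ∀ {x y v} → y ≢ 𝟏 → IntervalKernel A x y 𝟎 v → v ≢ 𝟎 →
    Separator A x y
  intervalKernel-𝟎⇒separator {x} {y} {v} y≢𝟏 (p , q) v≢𝟎 = v , v≢𝟎 , v≢𝟏 , inj₂ (v≤y , x⊓v≡𝟎)
    where
    v⊔y≡y : v ⊔ y ≡ y
    v⊔y≡y = trans (sym q) (⊔-identityˡ y)

    v≤y : v ≤ y
    v≤y = x⊔y≡y⇒x≤y v⊔y≡y

    x⊓v≡𝟎 : x ⊓ v ≡ 𝟎
    x⊓v≡𝟎 = trans (⊓-comm x v) (trans (sym p) (⊓-zeroˡ x))

    v≢𝟏 : v ≢ 𝟏
    v≢𝟏 v≡𝟏 = y≢𝟏 (trans (sym v⊔y≡y) (trans (cong (_⊔ y) v≡𝟏) (⊔-zeroˡ y)))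

  module _ (ci : Cond-i A) where
    private
      x≢𝟏⇒□x≡𝟎 : ∀ {x} → x ≢ 𝟏 → □ x ≡ 𝟎
      x≢𝟏⇒□x≡𝟎 {x} = proj₁ (proj₂ (ci x))

      x≢𝟎⇒◇x≡𝟏 : ∀ {x} → x ≢ 𝟎 → ◇ x ≡ 𝟏
      x≢𝟎⇒◇x≡𝟏 {x} = proj₂ (proj₂ (proj₂ (ci x)))

    separator-identifies-𝟎𝟏 : ∀ {θ} → IsCongruence A θ → ∀ {p q} → θ p q → Separator A p q →
      θ 𝟎 𝟏
    separator-identifies-𝟎𝟏 {θ} θ-cong {p} {q} θpq (c , c≢𝟎 , c≢𝟏 , inj₁ (p≤c , q⊔c≡𝟏)) =
      subst₂ θ (x≢𝟏⇒□x≡𝟎 c≢𝟏) □-𝟏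
        (□-cong (subst₂ θ (x≤y⇒x⊔y≡y p≤c) q⊔c≡𝟏 (⊔-cong θpq (θ-refl {c}))))
      where
      open IsCongruence θ-cong
      open IsEquivalence isEquivalence using () renaming (refl to θ-refl)
    separator-identifies-𝟎𝟏 {θ} θ-cong {p} {q} θpq (c , c≢𝟎 , c≢𝟏 , inj₂ (c≤q , p⊓c≡𝟎)) =
      subst₂ θ ◇-𝟎 (x≢𝟎⇒◇x≡𝟏 c≢𝟎)
        (◇-cong (subst₂ θ p⊓c≡𝟎 (trans (⊓-comm q c) c≤q) (⊓-cong θpq (θ-refl {c}))))
      where
      open IsCongruence θ-cong
      open IsEquivalence isEquivalence using () renaming (refl to θ-refl)

    module _ (em : ExcludedMiddle a) where
      □-determined : ∀ {u v} → (u ≡ 𝟏 → v ≡ 𝟏) → (v ≡ 𝟏 → u ≡ 𝟏) → □ u ≡ □ v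
      □-determined {u} {v} u⇒v v⇒u with em {u ≡ 𝟏}
      ... | yes u≡𝟏 = cong □ (trans u≡𝟏 (sym (u⇒v u≡𝟏)))
      ... | no u≢𝟏  = trans (x≢𝟏⇒□x≡𝟎 u≢𝟏) (sym (x≢𝟏⇒□x≡𝟎 (λ v≡𝟏 → u≢𝟏 (v⇒u v≡𝟏))))

      ◇-determined : ∀ {u v} → (u ≡ 𝟎 → v ≡ 𝟎) → (v ≡ 𝟎 → u ≡ 𝟎) → ◇ u ≡ ◇ v
      ◇-determined {u} {v} u⇒v v⇒u with em {u ≡ 𝟎}
      ... | yes u≡𝟎 = cong ◇ (trans u≡𝟎 (sym (u⇒v u≡𝟎)))
      ... | no u≢𝟎  = trans (x≢𝟎⇒◇x≡𝟏 u≢𝟎) (sym (x≢𝟎⇒◇x≡𝟏 (λ v≡𝟎 → u≢𝟎 (v⇒u v≡𝟎))))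

      Cond-i∧Cond-ii⇒collapsing : Cond-ii A → Collapsing A
      Cond-i∧Cond-ii⇒collapsing cii θ θ-cong {p} {q} (p≤q , p≢q) θpq with em {p ≡ 𝟎} | em {q ≡ 𝟏}
      ... | yes p≡𝟎 | _ = subst₂ θ (trans (cong ◇ p≡𝟎) ◇-𝟎)
                                   (x≢𝟎⇒◇x≡𝟏 λ q≡𝟎 → p≢q (trans p≡𝟎 (sym q≡𝟎)))
                                   (IsCongruence.◇-cong θ-cong θpq)
      ... | no _ | yes q≡𝟏 = subst₂ θ (x≢𝟏⇒□x≡𝟎 λ p≡𝟏 → p≢q (trans p≡𝟏 (sym q≡𝟏)))
                                      (trans (cong □ q≡𝟏) □-𝟏)
                                      (IsCongruence.□-cong θ-cong θpq)
      ... | no p≢𝟎 | no q≢𝟏 = separator-identifies-𝟎𝟏 θ-cong θpq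
            (cii p q (𝟎≤x p , λ 𝟎≡p → p≢𝟎 (sym 𝟎≡p)) (p≤q , p≢q) (x≤𝟏 q , q≢𝟏))

      simple⇒Cond-ii : Simple A → Cond-ii A
      simple⇒Cond-ii S x y (_ , 𝟎≢x) (x≤y , x≢y) (_ , y≢𝟏) = decidable-stable em no-separator-absurd
        where
        module _ (¬separator : ¬ Separator A x y) where
          𝟏-preserved : ∀ {u v} → IntervalKernel A x y u v → u ≡ 𝟏 → v ≡ 𝟏
          𝟏-preserved t refl = decidable-stable em λ v≢𝟏 →
            ¬separator (intervalKernel-𝟏⇒separator 𝟎≢x t v≢𝟏)

          𝟎-preserved : ∀ {u v} → IntervalKernel A x y u v → u ≡ 𝟎 → v ≡ 𝟎
          𝟎-preserved t refl = decidable-stable em λ v≢𝟎 →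
            ¬separator (intervalKernel-𝟎⇒separator y≢𝟏 t v≢𝟎)

          no-separator-absurd : ⊥
          no-separator-absurd with proj₂ S _ (intervalKernel-isCongruence
            (λ t → □-determined (𝟏-preserved t) (𝟏-preserved (intervalKernel-sym t)))
            (λ t → ◇-determined (𝟎-preserved t) (𝟎-preserved (intervalKernel-sym t))))
          ... | inj₁ identity = x≢y (identity x y
                  ( trans (⊓-idem x) (sym (trans (⊓-comm y x) x≤y))
                  , trans (x≤y⇒x⊔y≡y x≤y) (sym (⊔-idem y)) ))
          ... | inj₂ total = 𝟎≢x (trans (sym (⊓-zeroˡ x)) (trans (proj₁ (total 𝟎 𝟏)) (⊓-identityˡ x)))

lemma4p5 : ∀ {a : Level} → ExcludedMiddle a →
    (A : PositiveModalAlgebra a) → IsK4 A → NonTrivial A →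
    Simple A ⇔ (IsoToB₂ A ⊎ (Cond-i A × Cond-ii A))
lemma4p5 em A k4 nt = mk⇔ simple⇒characterisation characterisation⇒simple
  where
  open Properties A

  simple⇒characterisation : Simple A → IsoToB₂ A ⊎ (Cond-i A × Cond-ii A)
  simple⇒characterisation S with x≤□x⇒x≡𝟎⊎x≡𝟏 A S (proj₁ k4 𝟎)
  ... | inj₂ □𝟎≡𝟏 = inj₁ (twoValued⇒IsoToB₂ A (nonTrivial⇒𝟎≢𝟏 nt) (□𝟎≡𝟏⇒twoValued A S □𝟎≡𝟏)
                            (□𝟎≡𝟏⇒□x≡𝟏 □𝟎≡𝟏) (□𝟎≡𝟏⇒◇x≡𝟎 □𝟎≡𝟏))
  ... | inj₁ □𝟎≡𝟎 = inj₂ (ci , simple⇒Cond-ii A ci em S)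
    where
    ci : Cond-i A
    ci = simple⇒Cond-i A S k4 □𝟎≡𝟎

  characterisation⇒simple : IsoToB₂ A ⊎ (Cond-i A × Cond-ii A) → Simple A
  characterisation⇒simple (inj₁ iso) =
    collapsing⇒simple A em nt (twoValued⇒collapsing A (isoToB₂⇒twoValued A iso))
  characterisation⇒simple (inj₂ (ci , cii)) =
    collapsing⇒simple A em nt (Cond-i∧Cond-ii⇒collapsing A ci em cii)
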